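{- (1) For each $n\ge4$, $\mathbf K_{0,2}\le\mathbf K_{1,2}$ and $\mathbf K_{1,2}$ is isomorphic to a subalgebra of $\mathbf K_n^\emptyset$. (2) For $4\le m<n$ and every up-set $U$ of $X_m$, $\mathbf K_m^U$ is isomorphic to a subalgebra of $\mathbf K_n^{\tilde U}$, where $\tilde U$ is the up-set of $X_n$ generated by: each $(a_i,a_j)$ with $(a_i,a_j)\in U$ and $i,j<m-1$; each $(a_{n-1},a_j)$ such that $(a_{m-1},a_j)\in U$ and $j<m-1$; and $(a_{n-1},a_{n-1})$ if $(a_{m-1},a_{m-1})\in U$ (here the embedding is induced by $\mathbf{DP}_m\le\mathbf{DP}_n$ sending $a_1\mapsto a_1$, $a_k\mapsto a_k$ for $2\le k\le m-2$, $0\mapsto0$, $1\mapsto 1$).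
   Context: For a bounded commutative residuated lattice $\mathbf A$ (lattice, commutative monoid $(A,\cdot,1)$ with $ab\le c$ iff $a\le b\to c$, $1$ greatest, $0$ least), $K(\mathbf A)$ is the algebra on $A\times A$ with $(a,b)\vee(c,d)=(a\vee c,b\wedge d)$, $(a,b)\wedge(c,d)=(a\wedge c,b\vee d)$, $(a,b)(c,d)=(ac,(a\to d)\wedge(c\to b))$, $(a,b)\to(c,d)=((a\to c)\wedge(d\to b),ad)$, unit $(1,1)$, constant $0$ as $(0,1)$. The drastic product chain $\mathbf{DP}_n$ has universe $\{0=a_{n-1}<a_{n-2}<\dots<a_1<1\}$, product $xy=0$ if $x,y\ne1$ and $xy=x\wedge y$ otherwise, implication $x\to y=1$ if $x\le y$, $=a_1$ if $1>x>y$, $1\to y=y$. Note $\mathbf{DP}_3$ is the chain $\mathbf{Ł}_2=\{0,a_1,1\}$. Let $K_n^\emptyset=\{(x,1),(1,x),(x,a_1),(a_1,x):x\in DP_n\}$; $X_n=\{(a_i,a_j):i\ge j>1\}$ ordered coordinatewise; for an up-set $U$ of $X_n$, $K_n^U=K_n^\emptyset\cup\{(x,y):(x,y)\in U\text{ or }(y,x)\in U\}$, a subalgebra $\mathbf K_n^U$ of $K(\mathbf{DP}_n)$. With $u\oplus v=\min(1,u+v)$ on $\mathbf{Ł}_2=\{0,1/2,1\}$ (product $\max(0,x+y-1)$), $\mathbf K_{0,2}$ and $\mathbf K_{1,2}$ are the subalgebras of $K(\mathbf{Ł}_2)$ with universes $\{(u,v):u\oplus v=1\}$ and $\{(u,v):u\oplus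 v\ge 1/2\}$ respectively. -}

module Defs where

open import Data.Nat as ℕ using (ℕ; zero; suc; _+_; _∸_; _≤_; _<_; NonZero)
open import Data.Nat.Properties using (<⇒≤)
open import Data.Fin as F using (Fin; zero; suc; toℕ; fromℕ; inject≤)
open import Data.Product using (_×_; _,_; Σ; ∃; ∃-syntax)
open import Data.Sum using (_⊎_)
open import Relation.Binary.PropositionalEquality using (_≡_)
open import Relation.Nullary using (yes; no)

-- Signature of bounded commutative residuated lattices:
-- join, meet, product, residuum, unit 1 (= top) and constant 0.

record Ops (A : Set) : Set where
  field
    join meet mul imp : A → A → A
    one zer : A

K : {A : Set} → Ops A → Ops (A × A)
K {A} S = record
  { join = λ { (a , b) (c , d) → (a ∨ c , b ∧ d) }
  ; meet = λ { (a , b) (c , d) → (a ∧ c , b ∨ d) }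
  ; mul  = λ { (a , b) (c , d) → (a · c , (a ⇒ d) ∧ (c ⇒ b)) }
  ; imp  = λ { (a , b) (c , d) → ((a ⇒ c) ∧ (d ⇒ b) , a · d) }
  ; one  = (Ops.one S , Ops.one S)
  ; zer  = (Ops.zer S , Ops.one S)
  }
  where
  _∨_ _∧_ _·_ _⇒_ : A → A → A
  _∨_ = Ops.join S
  _∧_ = Ops.meet S
  _·_ = Ops.mul S
  _⇒_ = Ops.imp S

-- Embeddings of a subalgebra (given by a predicate P on the carrier of
-- an algebra) into a subalgebra (predicate Q): a map f, injective on P,
-- sending P into Q and preserving all operations and constants on P.
-- (f is total on the ambient carrier; its values outside P are irrelevant.)

record IsEmbedding {A B : Set} (SA : Ops A) (P : A → Set)
                   (SB : Ops B) (Q : B → Set) (f : A → B) : Set where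
  open Ops
  field
    into     : ∀ x → P x → Q (f x)
    injective : ∀ x y → P x → P y → f x ≡ f y → x ≡ y
    pres-join : ∀ x y → P x → P y → f (join SA x y) ≡ join SB (f x) (f y)
    pres-meet : ∀ x y → P x → P y → f (meet SA x y) ≡ meet SB (f x) (f y)
    pres-mul  : ∀ x y → P x → P y → f (mul SA x y) ≡ mul SB (f x) (f y)
    pres-imp  : ∀ x y → P x → P y → f (imp SA x y) ≡ imp SB (f x) (f y)
    pres-one  : f (one SA) ≡ one SB
    pres-zer  : f (zer SA) ≡ zer SB

Embeds : {A B : Set} → Ops A → (A → Set) → Ops B → (B → Set) → Set
Embeds {A} {B} SA P SB Q = Σ (A → B) (IsEmbedding SA P SB Q)

-- The drastic product chain DP_n on Fin n: the element i : Fin n stands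
-- for a_(toℕ i), with a_0 = 1 (top) and a_(n-1) = 0 (bottom).
-- So a_i ≤ a_j  iff  toℕ j ≤ toℕ i.

_≼_ : {n : ℕ} → Fin n → Fin n → Set
x ≼ y = toℕ y ≤ toℕ x

private
  a₁ : {k : ℕ} → Fin k → Fin (suc k)
  a₁ {suc k} _ = suc zero

  dpJoin dpMeet dpMul dpImp : {n : ℕ} → Fin n → Fin n → Fin n
  dpJoin x y with toℕ x ℕ.≤? toℕ y
  ... | yes _ = x
  ... | no  _ = y
  dpMeet x y with toℕ x ℕ.≤? toℕ y
  ... | yes _ = y
  ... | no  _ = x
  -- xy = x ∧ y if x = 1 or y = 1, and 0 otherwise
  dpMul zero y = y
  dpMul (suc i) zero = suc i
  dpMul {suc k} (suc i) (suc j) = fromℕ k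
  -- 1 → y = y;  x → y = 1 if x ≤ y;  x → y = a_1 if 1 > x > y
  dpImp zero y = y
  dpImp (suc i) y with toℕ y ℕ.≤? toℕ (suc i)
  ... | yes _ = zero
  ... | no  _ = a₁ i

DP : (n : ℕ) → {{NonZero n}} → Ops (Fin n)
DP (suc k) = record
  { join = dpJoin ; meet = dpMeet ; mul = dpMul ; imp = dpImp
  ; one = zero ; zer = fromℕ k }

≥4⇒NonZero : {n : ℕ} → 4 ≤ n → NonZero n
≥4⇒NonZero (ℕ.s≤s _) = _

K∅ : (n : ℕ) → Fin n × Fin n → Set
K∅ n (x , y) = (toℕ y ≡ 0 ⊎ toℕ x ≡ 0) ⊎ (toℕ y ≡ 1 ⊎ toℕ x ≡ 1)

InX : (n : ℕ) → Fin n × Fin n → Set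
InX n (i , j) = 1 < toℕ j × toℕ j ≤ toℕ i

_≤X_ : {n : ℕ} → Fin n × Fin n → Fin n × Fin n → Set
(x , y) ≤X (x' , y') = x ≼ x' × y ≼ y'

IsUpSet : (n : ℕ) → (Fin n × Fin n → Set) → Set
IsUpSet n U = (∀ p → U p → InX n p)
            × (∀ p q → U p → InX n q → p ≤X q → U q)

KU : (n : ℕ) → (Fin n × Fin n → Set) → Fin n × Fin n → Set
KU n U (x , y) = K∅ n (x , y) ⊎ (U (x , y) ⊎ U (y , x))

Gen : (m n : ℕ) → (Fin m × Fin m → Set) → Fin n × Fin n → Set
Gen m n U (i , j) =
    (∃[ i' ] ∃[ j' ] (U (i' , j') × toℕ i' < m ∸ 1 × toℕ j' < m ∸ 1
                      × toℕ i ≡ toℕ i' × toℕ j ≡ toℕ j'))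
  ⊎ ((toℕ i ≡ n ∸ 1) × ∃[ i' ] ∃[ j' ] (toℕ i' ≡ m ∸ 1 × U (i' , j')
                      × toℕ j' < m ∸ 1 × toℕ j ≡ toℕ j'))
  ⊎ ((toℕ i ≡ n ∸ 1) × (toℕ j ≡ n ∸ 1)
                      × ∃[ i' ] (toℕ i' ≡ m ∸ 1 × U (i' , i')))

Ũ : (m n : ℕ) → (Fin m × Fin m → Set) → Fin n × Fin n → Set
Ũ m n U p = InX n p × ∃[ g ] (Gen m n U g × g ≤X p)

emb : {m n : ℕ} → m < n → Fin m → Fin n
emb {m} {suc k} lt i with toℕ i ℕ.≟ m ∸ 1
... | yes _ = fromℕ k
... | no  _ = inject≤ i (<⇒≤ lt)

emb² : {m n : ℕ} → m < n → Fin m × Fin m → Fin n × Fin n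
emb² lt (x , y) = (emb lt x , emb lt y)

-- Ł_2 = {0, 1/2, 1}, encoded on Fin 3 by value (toℕ i)/2.

private
  clamp : ℕ → Fin 3
  clamp 0 = zero
  clamp 1 = suc zero
  clamp _ = suc (suc zero)

_⊕_ : Fin 3 → Fin 3 → Fin 3
u ⊕ v = clamp (toℕ u + toℕ v)                 -- min(1, u + v)

Ł2 : Ops (Fin 3)
Ł2 = record
  { join = λ x y → clamp (toℕ x ℕ.⊔ toℕ y)
  ; meet = λ x y → clamp (toℕ x ℕ.⊓ toℕ y)
  ; mul  = λ x y → clamp ((toℕ x + toℕ y) ∸ 2)  -- max(0, x + y - 1)
  ; imp  = λ x y → clamp ((2 ∸ toℕ x) + toℕ y)  -- min(1, 1 - x + y)
  ; one  = clamp 2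
  ; zer  = clamp 0 }

K02 : Fin 3 × Fin 3 → Set
K02 (u , v) = u ⊕ v ≡ Ops.one Ł2

K12 : Fin 3 × Fin 3 → Set
K12 (u , v) = 1 ≤ toℕ (u ⊕ v)

<⇒NonZero : {m n : ℕ} → m < n → NonZero n
<⇒NonZero (ℕ.s≤s _) = _

{-# OPTIONS --safe #-}
module Submission where

-- Both embeddings are induced coordinatewise by maps of the underlying
-- chains, and K(−) sends homomorphisms to homomorphisms.  On drastic
-- product chains every operation is determined by the order together with
-- the elements 1, a₁ and 0, so any order embedding DP_(2+a) → DP_(2+b)
-- fixing these three elements is a homomorphism; Ł₂ is isomorphic to DP₃.
-- What remains is to check that the induced maps send the given
-- subuniverses into the target ones.

open import Defs
open import Data.Nat as ℕ using (ℕ; zero; suc; _≤_; _<_; _≤?_; _≟_; z≤n; s≤s)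
open import Data.Nat.Properties as ℕ using (≤-refl; ≤-trans; ≤-antisym; ≤-reflexive; <⇒≤; ≤∧≢⇒<)
open import Data.Fin as F using (Fin; zero; suc; toℕ; fromℕ)
open import Data.Fin.Properties using (toℕ-injective; toℕ<n; toℕ-fromℕ; toℕ-inject≤; all?)
open import Data.Product using (_×_; _,_; ∃-syntax; proj₁; proj₂; map)
open import Data.Sum using (_⊎_; inj₁; inj₂)
open import Data.Empty using (⊥-elim)
open import Function using (_∘_)
open import Relation.Nullary using (Dec; yes; no; _→-dec_)
open import Relation.Nullary.Decidable using (True; toWitness)
open import Relation.Binary.PropositionalEquality

record IsHomomorphism {A B : Set} (SA : Ops A) (SB : Ops B) (f : A → B) : Set where
  open Ops
  field
    join-homo : ∀ x y → f (join SA x y) ≡ join SB (f x) (f y)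
    meet-homo : ∀ x y → f (meet SA x y) ≡ meet SB (f x) (f y)
    mul-homo  : ∀ x y → f (mul SA x y) ≡ mul SB (f x) (f y)
    imp-homo  : ∀ x y → f (imp SA x y) ≡ imp SB (f x) (f y)
    one-homo  : f (one SA) ≡ one SB
    zer-homo  : f (zer SA) ≡ zer SB

Injective : {A B : Set} → (A → B) → Set
Injective f = ∀ x y → f x ≡ f y → x ≡ y

map-injective : {A B : Set} {f : A → B} → Injective f → Injective (map f f)
map-injective inj (a , b) (c , d) e =
  cong₂ _,_ (inj a c (cong proj₁ e)) (inj b d (cong proj₂ e))

module _ {A B : Set} {SA : Ops A} {SB : Ops B} {f : A → B} where

  K-homomorphism : IsHomomorphism SA SB f → IsHomomorphism (K SA) (K SB) (map f f)
  K-homomorphism h = record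
    { join-homo = λ { (a , b) (c , d) → cong₂ _,_ (join-homo a c) (meet-homo b d) }
    ; meet-homo = λ { (a , b) (c , d) → cong₂ _,_ (meet-homo a c) (join-homo b d) }
    ; mul-homo  = λ { (a , b) (c , d) → cong₂ _,_ (mul-homo a c)
        (trans (meet-homo _ _) (cong₂ (Ops.meet SB) (imp-homo a d) (imp-homo c b))) }
    ; imp-homo  = λ { (a , b) (c , d) → cong₂ _,_
        (trans (meet-homo _ _) (cong₂ (Ops.meet SB) (imp-homo a c) (imp-homo d b)))
        (mul-homo a d) }
    ; one-homo  = cong₂ _,_ one-homo one-homo
    ; zer-homo  = cong₂ _,_ zer-homo one-homo
    }
    where open IsHomomorphism h

  homomorphism⇒embedding : {P : A → Set} {Q : B → Set} →
    IsHomomorphism SA SB f → Injective f → (∀ x → P x → Q (f x)) →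
    IsEmbedding SA P SB Q f
  homomorphism⇒embedding h inj into = record
    { into      = into
    ; injective = λ x y _ _ → inj x y
    ; pres-join = λ x y _ _ → join-homo x y
    ; pres-meet = λ x y _ _ → meet-homo x y
    ; pres-mul  = λ x y _ _ → mul-homo x y
    ; pres-imp  = λ x y _ _ → imp-homo x y
    ; pres-one  = one-homo
    ; pres-zer  = zer-homo
    }
    where open IsHomomorphism h

∘-homomorphism : {A B C : Set} {SA : Ops A} {SB : Ops B} {SC : Ops C}
  {f : A → B} {g : B → C} →
  IsHomomorphism SB SC g → IsHomomorphism SA SB f → IsHomomorphism SA SC (g ∘ f)
∘-homomorphism {g = g} hg hf = record
  { join-homo = λ x y → trans (cong g (Hf.join-homo x y)) (Hg.join-homo _ _)
  ; meet-homo = λ x y → trans (cong g (Hf.meet-homo x y)) (Hg.meet-homo _ _)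
  ; mul-homo  = λ x y → trans (cong g (Hf.mul-homo x y)) (Hg.mul-homo _ _)
  ; imp-homo  = λ x y → trans (cong g (Hf.imp-homo x y)) (Hg.imp-homo _ _)
  ; one-homo  = trans (cong g Hf.one-homo) Hg.one-homo
  ; zer-homo  = trans (cong g Hf.zer-homo) Hg.zer-homo
  }
  where
  module Hf = IsHomomorphism hf
  module Hg = IsHomomorphism hg

by-exhaustion : {m n : ℕ} {P : Fin m → Fin n → Set} (P? : ∀ x y → Dec (P x y)) →
  {True (all? λ x → all? (P? x))} → ∀ x y → P x y
by-exhaustion P? {w} = toWitness w

order-reflecting⇒injective : {m n : ℕ} {f : Fin m → Fin n} →
  (∀ {x y} → toℕ (f x) ≤ toℕ (f y) → toℕ x ≤ toℕ y) → Injective f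
order-reflecting⇒injective f-reflects x y e = toℕ-injective (≤-antisym
  (f-reflects (≤-reflexive (cong toℕ e)))
  (f-reflects (≤-reflexive (cong toℕ (sym e)))))

module OrderEmbedding {a b : ℕ} (f : Fin (suc (suc a)) → Fin (suc (suc b)))
  (f-mono     : ∀ {x y} → toℕ x ≤ toℕ y → toℕ (f x) ≤ toℕ (f y))
  (f-reflects : ∀ {x y} → toℕ (f x) ≤ toℕ (f y) → toℕ x ≤ toℕ y)
  (f-one      : f zero ≡ zero)
  (f-a₁       : f (suc zero) ≡ suc zero)
  (f-zer      : f (fromℕ (suc a)) ≡ fromℕ (suc b)) where

  f-suc : ∀ i → ∃[ j ] f (suc i) ≡ suc j
  f-suc i with f (suc i) in e
  ... | suc j = j , refl
  ... | zero with f-reflects {suc i} {zero} (≤-reflexive (cong toℕ (trans e (sym f-one))))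
  ... | ()

  homomorphism : IsHomomorphism (DP (suc (suc a))) (DP (suc (suc b))) f
  homomorphism = record
    { join-homo = join-homo ; meet-homo = meet-homo ; mul-homo = mul-homo
    ; imp-homo = imp-homo ; one-homo = f-one ; zer-homo = f-zer }
    where
    SA = DP (suc (suc a))
    SB = DP (suc (suc b))

    join-homo : ∀ x y → f (Ops.join SA x y) ≡ Ops.join SB (f x) (f y)
    join-homo x y with toℕ x ≤? toℕ y | toℕ (f x) ≤? toℕ (f y)
    ... | yes _ | yes _ = refl
    ... | yes p | no q  = ⊥-elim (q (f-mono p))
    ... | no p  | yes q = ⊥-elim (p (f-reflects q))
    ... | no _  | no _  = refl

    meet-homo : ∀ x y → f (Ops.meet SA x y) ≡ Ops.meet SB (f x) (f y)
    meet-homo x y with toℕ x ≤? toℕ y | toℕ (f x) ≤? toℕ (f y)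
    ... | yes _ | yes _ = refl
    ... | yes p | no q  = ⊥-elim (q (f-mono p))
    ... | no p  | yes q = ⊥-elim (p (f-reflects q))
    ... | no _  | no _  = refl

    mul-homo : ∀ x y → f (Ops.mul SA x y) ≡ Ops.mul SB (f x) (f y)
    mul-homo zero y rewrite f-one = refl
    mul-homo (suc i) zero rewrite f-one | proj₂ (f-suc i) = refl
    mul-homo (suc i) (suc j) rewrite proj₂ (f-suc i) | proj₂ (f-suc j) = f-zer

    imp-homo : ∀ x y → f (Ops.imp SA x y) ≡ Ops.imp SB (f x) (f y)
    imp-homo zero y rewrite f-one = refl
    imp-homo (suc i) y with f-suc i
    ... | j , e rewrite e with toℕ y ≤? toℕ (suc i) | toℕ (f y) ≤? toℕ (suc j)
    ... | yes _ | yes _ = f-one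
    ... | yes p | no q  = ⊥-elim (q (subst (λ z → toℕ (f y) ≤ toℕ z) e (f-mono p)))
    ... | no p  | yes q = ⊥-elim (p (f-reflects (subst (λ z → toℕ (f y) ≤ toℕ z) (sym e) q)))
    ... | no _  | no _  = f-a₁

Ł₂→DP₃ : Fin 3 → Fin 3
Ł₂→DP₃ zero             = suc (suc zero)
Ł₂→DP₃ (suc zero)       = suc zero
Ł₂→DP₃ (suc (suc zero)) = zero

Ł₂→DP₃-homomorphism : IsHomomorphism Ł2 (DP 3) Ł₂→DP₃
Ł₂→DP₃-homomorphism = record
  { join-homo = by-exhaustion λ x y → h (Ops.join Ł2 x y) F.≟ Ops.join (DP 3) (h x) (h y)
  ; meet-homo = by-exhaustion λ x y → h (Ops.meet Ł2 x y) F.≟ Ops.meet (DP 3) (h x) (h y)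
  ; mul-homo  = by-exhaustion λ x y → h (Ops.mul Ł2 x y) F.≟ Ops.mul (DP 3) (h x) (h y)
  ; imp-homo  = by-exhaustion λ x y → h (Ops.imp Ł2 x y) F.≟ Ops.imp (DP 3) (h x) (h y)
  ; one-homo  = refl
  ; zer-homo  = refl
  }
  where h = Ł₂→DP₃

Ł₂→DP₃-injective : Injective Ł₂→DP₃
Ł₂→DP₃-injective = by-exhaustion λ x y → (Ł₂→DP₃ x F.≟ Ł₂→DP₃ y) →-dec (x F.≟ y)

DP₃→DP : (b : ℕ) → Fin 3 → Fin (suc (suc b))
DP₃→DP b zero             = zero
DP₃→DP b (suc zero)       = suc zero
DP₃→DP b (suc (suc zero)) = fromℕ (suc b)

module DP₃↪DP {b : ℕ} (1≤b : 1 ≤ b) where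

  mono : ∀ {x y} → toℕ x ≤ toℕ y → toℕ (DP₃→DP b x) ≤ toℕ (DP₃→DP b y)
  mono {zero}           {_}              _ = z≤n
  mono {suc zero}       {suc zero}       _ = ≤-refl
  mono {suc zero}       {suc (suc zero)} _ = subst (1 ≤_) (sym (toℕ-fromℕ (suc b))) (s≤s z≤n)
  mono {suc (suc zero)} {suc (suc zero)} _ = ≤-refl
  mono {suc (suc zero)} {suc zero}       (s≤s ())

  reflects : ∀ {x y} → toℕ (DP₃→DP b x) ≤ toℕ (DP₃→DP b y) → toℕ x ≤ toℕ y
  reflects {zero}           {_}              _ = z≤n
  reflects {suc zero}       {suc zero}       _ = ≤-refl
  reflects {suc zero}       {suc (suc zero)} _ = s≤s z≤n
  reflects {suc (suc zero)} {suc (suc zero)} _ = ≤-refl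
  reflects {suc zero}       {zero}           ()
  reflects {suc (suc zero)} {zero}           p with subst (_≤ 0) (toℕ-fromℕ (suc b)) p
  ... | ()
  reflects {suc (suc zero)} {suc zero}       p with ≤-trans 1≤b (ℕ.≤-pred (subst (_≤ 1) (toℕ-fromℕ (suc b)) p))
  ... | ()

  open OrderEmbedding (DP₃→DP b) mono reflects refl refl refl public

Ł₂→DP : (b : ℕ) → Fin 3 → Fin (suc (suc b))
Ł₂→DP b = DP₃→DP b ∘ Ł₂→DP₃

-- Only the point (0, 0) of Ł₂² is missing from K_{1,2}; every other point has
-- a coordinate 1/2 or 1, which goes to a₁ or 1 in DP_n.
K12⊆K∅ : (b : ℕ) → ∀ p → K12 p → K∅ (suc (suc b)) (map (Ł₂→DP b) (Ł₂→DP b) p)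
K12⊆K∅ b (zero , zero) ()
K12⊆K∅ b (zero , suc zero) _ = inj₂ (inj₁ refl)
K12⊆K∅ b (zero , suc (suc zero)) _ = inj₁ (inj₁ refl)
K12⊆K∅ b (suc zero , _) _ = inj₂ (inj₂ refl)
K12⊆K∅ b (suc (suc zero) , _) _ = inj₁ (inj₂ refl)

KŁ₂↪K∅ : (b : ℕ) → 1 ≤ b → Embeds (K Ł2) K12 (K (DP (suc (suc b)))) (K∅ (suc (suc b)))
KŁ₂↪K∅ b 1≤b = map (Ł₂→DP b) (Ł₂→DP b) , homomorphism⇒embedding
  (K-homomorphism (∘-homomorphism homomorphism Ł₂→DP₃-homomorphism))
  (map-injective λ x y → Ł₂→DP₃-injective x y ∘ order-reflecting⇒injective reflects (Ł₂→DP₃ x) (Ł₂→DP₃ y))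
  (K12⊆K∅ b)
  where open DP₃↪DP 1≤b

K02⊆K12 : ∀ p → K02 p → K12 p
K02⊆K12 p e = subst (λ z → 1 ≤ toℕ z) (sym e) (s≤s z≤n)

module _ {m k : ℕ} (lt : suc m < suc k) where

  emb-cases : ∀ i → (toℕ i ≡ m × toℕ (emb lt i) ≡ k) ⊎ (toℕ i ≢ m × toℕ (emb lt i) ≡ toℕ i)
  emb-cases i with toℕ i ≟ m
  ... | yes p = inj₁ (p , toℕ-fromℕ k)
  ... | no p  = inj₂ (p , toℕ-inject≤ i (<⇒≤ lt))

  private
    toℕ≤m : ∀ (i : Fin (suc m)) → toℕ i ≤ m
    toℕ≤m i = ℕ.≤-pred (toℕ<n i)

    m<k : m < k
    m<k = ℕ.≤-pred lt

  emb-fixes : ∀ {t} i → toℕ i ≡ t → t < m → toℕ (emb lt i) ≡ t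
  emb-fixes i refl p with emb-cases i
  ... | inj₁ (e , _) = ⊥-elim (ℕ.<-irrefl e p)
  ... | inj₂ (_ , e) = e

  emb-bottom : emb lt (fromℕ m) ≡ fromℕ k
  emb-bottom with emb-cases (fromℕ m)
  ... | inj₁ (_ , e) = toℕ-injective (trans e (sym (toℕ-fromℕ k)))
  ... | inj₂ (q , _) = ⊥-elim (q (toℕ-fromℕ m))

  emb-mono : ∀ {x y} → toℕ x ≤ toℕ y → toℕ (emb lt x) ≤ toℕ (emb lt y)
  emb-mono {x} {y} p with emb-cases x | emb-cases y
  ... | inj₁ (_ , ex)  | inj₁ (_ , ey)  = ≤-reflexive (trans ex (sym ey))
  ... | inj₁ (qx , _)  | inj₂ (qy , _)  = ⊥-elim (qy (≤-antisym (toℕ≤m y) (subst (_≤ toℕ y) qx p)))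
  ... | inj₂ (_ , ex)  | inj₁ (_ , ey)  = subst₂ _≤_ (sym ex) (sym ey) (≤-trans (toℕ≤m x) (<⇒≤ m<k))
  ... | inj₂ (_ , ex)  | inj₂ (_ , ey)  = subst₂ _≤_ (sym ex) (sym ey) p

  emb-reflects : ∀ {x y} → toℕ (emb lt x) ≤ toℕ (emb lt y) → toℕ x ≤ toℕ y
  emb-reflects {x} {y} p with emb-cases x | emb-cases y
  ... | inj₁ (qx , _)  | inj₁ (qy , _)  = ≤-reflexive (trans qx (sym qy))
  ... | inj₁ (_ , ex)  | inj₂ (_ , ey)  =
    ⊥-elim (ℕ.<-irrefl refl (ℕ.≤-<-trans (subst₂ _≤_ ex ey p) (ℕ.≤-<-trans (toℕ≤m y) m<k)))
  ... | inj₂ _         | inj₁ (qy , _)  = subst (toℕ x ≤_) (sym qy) (toℕ≤m x)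
  ... | inj₂ (_ , ex)  | inj₂ (_ , ey)  = subst₂ _≤_ ex ey p

  emb²-U⊆Ũ : (U : Fin (suc m) × Fin (suc m) → Set) → (∀ p → U p → InX (suc m) p) →
             ∀ x y → U (x , y) → Ũ (suc m) (suc k) U (emb lt x , emb lt y)
  emb²-U⊆Ũ U U⊆X x y u = inX , (emb lt x , emb lt y) , generator , (≤-refl , ≤-refl)
    where
    1<y = proj₁ (U⊆X (x , y) u)
    y≤x = proj₂ (U⊆X (x , y) u)

    inX : InX (suc k) (emb lt x , emb lt y)
    inX with emb-cases y
    ... | inj₁ (qy , ey) =
      subst (1 <_) (sym ey) (ℕ.<-≤-trans (subst (1 <_) qy 1<y) (<⇒≤ m<k)) , emb-mono y≤x
    ... | inj₂ (_ , ey)  = subst (1 <_) (sym ey) 1<y , emb-mono y≤x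

    generator : Gen (suc m) (suc k) U (emb lt x , emb lt y)
    generator with emb-cases x | emb-cases y
    ... | inj₂ (qx , ex) | inj₂ (qy , ey) =
      inj₁ (x , y , u , ≤∧≢⇒< (toℕ≤m x) qx , ≤∧≢⇒< (toℕ≤m y) qy , ex , ey)
    ... | inj₁ (qx , ex) | inj₂ (qy , ey) =
      inj₂ (inj₁ (ex , x , y , qx , u , ≤∧≢⇒< (toℕ≤m y) qy , ey))
    ... | inj₁ (qx , ex) | inj₁ (qy , ey) =
      inj₂ (inj₂ (ex , ey , x , qx , subst (λ z → U (x , z)) (toℕ-injective (trans qy (sym qx))) u))
    ... | inj₂ (qx , _)  | inj₁ (qy , _)  =
      ⊥-elim (qx (≤-antisym (toℕ≤m x) (subst (_≤ toℕ x) qy y≤x)))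

module _ {c b : ℕ} (lt : suc (suc (suc c)) < suc (suc b)) where

  emb-homomorphism : IsHomomorphism (DP (suc (suc (suc c)))) (DP (suc (suc b))) (emb lt)
  emb-homomorphism = OrderEmbedding.homomorphism (emb lt) (emb-mono lt) (emb-reflects lt)
    (toℕ-injective (emb-fixes lt zero refl (s≤s z≤n)))
    (toℕ-injective (emb-fixes lt (suc zero) refl (s≤s (s≤s z≤n))))
    (emb-bottom lt)

  emb²-K∅⊆K∅ : ∀ p → K∅ (suc (suc (suc c))) p → K∅ (suc (suc b)) (emb² lt p)
  emb²-K∅⊆K∅ (x , y) (inj₁ (inj₁ e)) = inj₁ (inj₁ (emb-fixes lt y e (s≤s z≤n)))
  emb²-K∅⊆K∅ (x , y) (inj₁ (inj₂ e)) = inj₁ (inj₂ (emb-fixes lt x e (s≤s z≤n)))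
  emb²-K∅⊆K∅ (x , y) (inj₂ (inj₁ e)) = inj₂ (inj₁ (emb-fixes lt y e (s≤s (s≤s z≤n))))
  emb²-K∅⊆K∅ (x , y) (inj₂ (inj₂ e)) = inj₂ (inj₂ (emb-fixes lt x e (s≤s (s≤s z≤n))))

  emb²-KU⊆KŨ : (U : Fin (suc (suc (suc c))) × Fin (suc (suc (suc c))) → Set) →
    (∀ p → U p → InX (suc (suc (suc c))) p) → ∀ p → KU (suc (suc (suc c))) U p →
    KU (suc (suc b)) (Ũ (suc (suc (suc c))) (suc (suc b)) U) (emb² lt p)
  emb²-KU⊆KŨ U U⊆X p       (inj₁ k)        = inj₁ (emb²-K∅⊆K∅ p k)
  emb²-KU⊆KŨ U U⊆X (x , y) (inj₂ (inj₁ u)) = inj₂ (inj₁ (emb²-U⊆Ũ lt U U⊆X x y u))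
  emb²-KU⊆KŨ U U⊆X (x , y) (inj₂ (inj₂ u)) = inj₂ (inj₂ (emb²-U⊆Ũ lt U U⊆X y x u))

theorem3p8 :
    ((n : ℕ) → (h : 4 ≤ n) →
      (∀ p → K02 p → K12 p)
      × Embeds (K Ł2) K12 (K (DP n {{≥4⇒NonZero h}})) (K∅ n))
    × ((m n : ℕ) → (hm : 4 ≤ m) → (lt : m < n) →
       (U : Fin m × Fin m → Set) → IsUpSet m U →
       IsEmbedding (K (DP m {{≥4⇒NonZero hm}})) (KU m U)
                   (K (DP n {{<⇒NonZero lt}}))
                   (KU n (Ũ m n U)) (emb² lt))
theorem3p8 = part₁ , part₂
  where
  part₁ : (n : ℕ) → (h : 4 ≤ n) →
    (∀ p → K02 p → K12 p) × Embeds (K Ł2) K12 (K (DP n {{≥4⇒NonZero h}})) (K∅ n)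
  part₁ (suc (suc b)) (s≤s (s≤s 2≤b)) = K02⊆K12 , KŁ₂↪K∅ b (≤-trans (s≤s z≤n) 2≤b)

  part₂ : (m n : ℕ) → (hm : 4 ≤ m) → (lt : m < n) →
    (U : Fin m × Fin m → Set) → IsUpSet m U →
    IsEmbedding (K (DP m {{≥4⇒NonZero hm}})) (KU m U) (K (DP n {{<⇒NonZero lt}}))
                (KU n (Ũ m n U)) (emb² lt)
  part₂ (suc (suc (suc c))) (suc (suc b)) (s≤s (s≤s (s≤s _))) lt U (U⊆X , _) =
    homomorphism⇒embedding (K-homomorphism (emb-homomorphism lt))
      (map-injective (order-reflecting⇒injective (emb-reflects lt))) (emb²-KU⊆KŨ lt U U⊆X)
  part₂ (suc (suc (suc c))) zero       _ ()          _ _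
  part₂ (suc (suc (suc c))) (suc zero) _ (s≤s ()) _ _
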